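{- Let $G=(V,E)$ be a graph with $m=|E|$ edges, so $\mathrm{Vol}(V)=2m$, let $\pi$ be any ordering (permutation) of $V$, and let $\phi\le 1/12$. If for some index $j$ we have $\Phi(\pi(1..j))\le\phi$ and $\mathrm{Vol}(\pi(1..j))\le \frac56\mathrm{Vol}(V)$, then $\Phi(\pi(1..j'))\le 12\phi$ for every index $j'>j$ with $\mathrm{Vol}(\pi(1..j'))\le (1+\phi)\mathrm{Vol}(\pi(1..j))$.
   Context: $\pi(1..j)$ denotes the set $\{\pi(1),\ldots,\pi(j)\}$ of the first $j$ vertices in the ordering. $\mathrm{Vol}(S)=\sum_{v\in S}\deg(v)$, $\partial(S)$ is the set of edges with exactly one endpoint in $S$, and $\Phi(S)=|\partial(S)|/\min(\mathrm{Vol}(S),\mathrm{Vol}(V\setminus S))$. -}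

module Defs where

open import Data.Nat using (ℕ; zero; suc; _+_; _<ᵇ_; _≤_)
open import Data.Nat.Properties using (_≟_)
open import Data.Bool using (Bool; true; false; not; _xor_; _∨_; _∧_; if_then_else_)
open import Data.Fin using (Fin; toℕ)
open import Data.Fin.Properties using () renaming (_≟_ to _≟ᶠ_)
open import Data.Fin.Permutation using (Permutation′; _⟨$⟩ˡ_)
open import Data.List using (List; []; _∷_; map; allFin; length; filterᵇ)
open import Data.Nat.ListAction using (sum)
open import Data.List.Relation.Unary.All using (All)
open import Data.List.Relation.Unary.AllPairs using (AllPairs)
open import Data.Product using (_×_; _,_; proj₁; proj₂)
open import Data.Integer using (+_)
open import Data.Rational using (ℚ; 0ℚ; _/_)
open import Relation.Binary.PropositionalEquality using (_≡_)
open import Relation.Nullary using (¬_; does)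

-- A finite simple undirected graph on the vertex set Fin n, given by its
-- list of edges (each edge an unordered pair stored as an ordered pair).
record Graph : Set where
  field
    n     : ℕ
    edges : List (Fin n × Fin n)
    loopless : All (λ e → ¬ (proj₁ e ≡ proj₂ e)) edges
    noMulti  : AllPairs (λ e f → ¬ (e ≡ f) × ¬ (proj₁ e ≡ proj₂ f × proj₂ e ≡ proj₁ f)) edges

open Graph public

VSet : Graph → Set
VSet G = Fin (n G) → Bool

numEdges : Graph → ℕ
numEdges G = length (edges G)

deg : (G : Graph) → Fin (n G) → ℕ
deg G v = length (filterᵇ (λ e → does (proj₁ e ≟ᶠ v)) (edges G))
        + length (filterᵇ (λ e → does (proj₂ e ≟ᶠ v)) (edges G))

Vol : (G : Graph) → VSet G → ℕ
Vol G S = sum (map (λ v → if S v then deg G v else 0) (allFin (n G)))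

compl : (G : Graph) → VSet G → VSet G
compl G S v = not (S v)

full : (G : Graph) → VSet G
full G v = true

boundary : (G : Graph) → VSet G → ℕ
boundary G S = length (filterᵇ (λ e → S (proj₁ e) xor S (proj₂ e)) (edges G))

minVol : (G : Graph) → VSet G → ℕ
minVol G S = Data.Nat._⊓_ (Vol G S) (Vol G (compl G S))
  where import Data.Nat

-- conductance Φ(S) = |∂S| / min(Vol S, Vol(V∖S)); convention: 0 when the
-- denominator is 0 (in that case |∂S| = 0 as well, so Φ(S) = 0/0).
Φ : (G : Graph) → VSet G → ℚ
Φ G S with minVol G S
... | zero  = 0ℚ
... | suc k = (+ boundary G S) / suc k

-- π(1..j) = {π(1), …, π(j)}; with π : Fin n ↔ Fin n, π(i) (1-indexed)
-- is π ⟨$⟩ʳ (i-1), so v ∈ π(1..j) iff toℕ (π⁻¹ v) < j.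
prefix : (G : Graph) → Permutation′ (n G) → ℕ → VSet G
prefix G π j v = toℕ (π ⟨$⟩ˡ v) <ᵇ j

module Submission where

-- Write S = π(1..j), S′ = π(1..j′) with S ⊆ S′, a = Vol S, c = Vol (V∖S),
-- a′ = Vol S′, c′ = Vol (V∖S′), b = |∂S|, b′ = |∂S′|, and φ = p/D.
-- Counting over edges gives four combinatorial facts valid for any S ⊆ S′:
-- a ≤ a′, a + c = a′ + c′, b ≤ min(a, c), and the boundary-growth bound
-- b′ + a ≤ b + a′ (every edge newly cut by S′ has an endpoint in S′∖S).
-- Together with the hypotheses b ≤ φ·min(a, c), a ≤ 5c and a′ ≤ (1+φ)a
-- these give b′ ≤ φ·min(a, c) + φ·a; if S′ is the smaller side this is at
-- most 2φa′, and otherwise c′ ≥ c − φa ≥ (c + a)/12 because a ≤ 5c and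
-- φ ≤ 1/12, so b′ ≤ φ(c + a) ≤ 12φc′.

open import Defs

module EdgeCounting where

  open import Algebra.Properties.CommutativeSemigroup using (interchange)
  import Algebra.Properties.CommutativeMonoid.Sum as MonoidSum
  open import Data.Bool using (Bool; true; false; not; _xor_; if_then_else_; T; f≤t; b≤b)
    renaming (_≤_ to _≤𝔹_)
  open import Data.Bool.Properties using (not-involutive)
  open import Data.Fin using (Fin) renaming (zero to fzero; suc to fsuc)
  open import Data.Fin.Permutation using (Permutation′)
  open import Data.Fin.Properties using (_≟_)
  open import Data.List using (List; []; _∷_; map; allFin; length; filterᵇ; tabulate)
  open import Data.List.Properties using (map-tabulate; map-cong)
  open import Data.Nat using (ℕ; zero; suc; _+_; _≤_; z≤n)
  open import Data.Nat.ListAction using (sum)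
  open import Data.Nat.Properties hiding (_≟_)
  open import Data.Product using (_×_; proj₁; proj₂)
  open import Function using (_∘_)
  open import Relation.Binary.PropositionalEquality
  open import Relation.Nullary using (does)

  module ∑ = MonoidSum +-0-commutativeMonoid
  open ∑ using (sum-syntax)

  𝟙 : Bool → ℕ
  𝟙 b = if b then 1 else 0

  length-filterᵇ : ∀ {A : Set} (P : A → Bool) (xs : List A) →
    length (filterᵇ P xs) ≡ sum (map (𝟙 ∘ P) xs)
  length-filterᵇ P [] = refl
  length-filterᵇ P (x ∷ xs) with P x
  ... | true  = cong suc (length-filterᵇ P xs)
  ... | false = length-filterᵇ P xs

  sum-map-+ : ∀ {A : Set} (f g : A → ℕ) (xs : List A) →
    sum (map (λ x → f x + g x) xs) ≡ sum (map f xs) + sum (map g xs)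
  sum-map-+ f g [] = refl
  sum-map-+ f g (x ∷ xs) =
    trans (cong ((f x + g x) +_) (sum-map-+ f g xs))
          (interchange +-commutativeSemigroup (f x) (g x) _ _)

  sum-map-mono : ∀ {A : Set} {f g : A → ℕ} (xs : List A) →
    (∀ x → f x ≤ g x) → sum (map f xs) ≤ sum (map g xs)
  sum-map-mono [] f≤g = z≤n
  sum-map-mono (x ∷ xs) f≤g = +-mono-≤ (f≤g x) (sum-map-mono xs f≤g)

  sum-allFin : ∀ n (f : Fin n → ℕ) → sum (map f (allFin n)) ≡ ∑[ v < n ] f v
  sum-allFin n f = trans (cong sum (map-tabulate (λ v → v) f)) (sum-tabulate n f)
    where
    sum-tabulate : ∀ n (f : Fin n → ℕ) → sum (tabulate f) ≡ ∑[ v < n ] f v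
    sum-tabulate zero    f = refl
    sum-tabulate (suc n) f = cong (f fzero +_) (sum-tabulate n (f ∘ fsuc))

  sum-if-0 : ∀ n (S : Fin n → Bool) → ∑[ v < n ] (if S v then 0 else 0) ≡ 0
  sum-if-0 n S = trans (∑.sum-cong-≗ {n} (λ v → if-0 (S v))) (∑.sum-replicate-zero n)
    where
    if-0 : ∀ b → (if b then 0 else 0) ≡ 0
    if-0 true  = refl
    if-0 false = refl

  sum-spike : ∀ n (S : Fin n → Bool) (x : Fin n) →
    ∑[ v < n ] (if S v then 𝟙 (does (x ≟ v)) else 0) ≡ 𝟙 (S x)
  sum-spike (suc n) S fzero with S fzero
  ... | true  = cong suc (sum-if-0 n (S ∘ fsuc))
  ... | false = sum-if-0 n (S ∘ fsuc)
  sum-spike (suc n) S (fsuc x) with S fzero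
  ... | true  = sum-spike n (S ∘ fsuc) x
  ... | false = sum-spike n (S ∘ fsuc) x

  _⊆_ : ∀ {A : Set} → (A → Bool) → (A → Bool) → Set
  S ⊆ S′ = ∀ v → S v ≤𝔹 S′ v

  T⇒≤𝔹 : ∀ {x y : Bool} → (T x → T y) → x ≤𝔹 y
  T⇒≤𝔹 {false} {false} _ = b≤b
  T⇒≤𝔹 {false} {true}  _ = f≤t
  T⇒≤𝔹 {true}  {true}  _ = b≤b
  T⇒≤𝔹 {true}  {false} x⇒y with () ← x⇒y _

  prefix-mono : ∀ G (π : Permutation′ (n G)) {j j′} → j ≤ j′ → prefix G π j ⊆ prefix G π j′
  prefix-mono G π j≤j′ v = T⇒≤𝔹 (λ i<j → <⇒<ᵇ (<-≤-trans (<ᵇ⇒< _ _ i<j) j≤j′))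

  endpointsIn : ∀ {A : Set} → (A → Bool) → A × A → ℕ
  endpointsIn S e = 𝟙 (S (proj₁ e)) + 𝟙 (S (proj₂ e))

  crosses : ∀ {A : Set} → (A → Bool) → A × A → Bool
  crosses S e = S (proj₁ e) xor S (proj₂ e)

  incidence : ∀ {n} → Fin n × Fin n → Fin n → ℕ
  incidence e v = 𝟙 (does (proj₁ e ≟ v)) + 𝟙 (does (proj₂ e ≟ v))

  deg-incidence : ∀ G v → deg G v ≡ sum (map (λ e → incidence e v) (edges G))
  deg-incidence G v =
    trans (cong₂ _+_ (length-filterᵇ _ (edges G)) (length-filterᵇ _ (edges G)))
          (sym (sum-map-+ _ _ (edges G)))

  boundary-edges : ∀ G S → boundary G S ≡ sum (map (𝟙 ∘ crosses S) (edges G))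
  boundary-edges G S = length-filterᵇ (crosses S) (edges G)

  -- Double counting: summing the degrees over S counts every edge once for
  -- each of its endpoints in S.
  double-count : ∀ {n} (S : Fin n → Bool) (E : List (Fin n × Fin n)) →
    ∑[ v < n ] (if S v then sum (map (λ e → incidence e v) E) else 0)
      ≡ sum (map (endpointsIn S) E)
  double-count {n} S [] = sum-if-0 n S
  double-count {n} S (e ∷ E) = begin
      ∑[ v < n ] (if S v then incidence e v + rest v else 0)
    ≡⟨ ∑.sum-cong-≗ {n} distribute ⟩
      ∑[ v < n ] ((end₁ v + end₂ v) + (if S v then rest v else 0))
    ≡⟨ ∑.∑-distrib-+ (λ v → end₁ v + end₂ v) _ ⟩
      ∑[ v < n ] (end₁ v + end₂ v) + ∑[ v < n ] (if S v then rest v else 0)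
    ≡⟨ cong₂ _+_ (∑.∑-distrib-+ end₁ end₂) (double-count S E) ⟩
      (∑[ v < n ] end₁ v + ∑[ v < n ] end₂ v) + sum (map (endpointsIn S) E)
    ≡⟨ cong (_+ sum (map (endpointsIn S) E))
            (cong₂ _+_ (sum-spike n S (proj₁ e)) (sum-spike n S (proj₂ e))) ⟩
      endpointsIn S e + sum (map (endpointsIn S) E)
    ∎
    where
    open ≡-Reasoning
    rest : Fin n → ℕ
    rest v = sum (map (λ e → incidence e v) E)
    end₁ end₂ : Fin n → ℕ
    end₁ v = if S v then 𝟙 (does (proj₁ e ≟ v)) else 0
    end₂ v = if S v then 𝟙 (does (proj₂ e ≟ v)) else 0
    distribute : ∀ v → (if S v then incidence e v + rest v else 0)
                       ≡ (end₁ v + end₂ v) + (if S v then rest v else 0)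
    distribute v with S v
    ... | true  = refl
    ... | false = refl

  Vol-edges : ∀ G S → Vol G S ≡ sum (map (endpointsIn S) (edges G))
  Vol-edges G S =
    trans (sum-allFin (n G) _)
          (trans (∑.sum-cong-≗ {n G} (λ v → cong (if S v then_else 0) (deg-incidence G v)))
                 (double-count S (edges G)))

  -- In the following, x, y (and x′, y′) are the memberships of the two
  -- endpoints of an edge in S (and in S′).

  𝟙-mono : ∀ {x y} → x ≤𝔹 y → 𝟙 x ≤ 𝟙 y
  𝟙-mono f≤t = z≤n
  𝟙-mono b≤b = ≤-refl

  -- If an edge is cut by the larger set but not by the smaller one, one of
  -- its endpoints entered the set: the cut indicator grows by at most the
  -- growth of the endpoint count. Each case is a closed inequality between
  -- numerals, checked by evaluating _≤ᵇ_.
  cut-growth : ∀ {x x′ y y′} → x ≤𝔹 x′ → y ≤𝔹 y′ →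
    𝟙 (x′ xor y′) + (𝟙 x + 𝟙 y) ≤ 𝟙 (x xor y) + (𝟙 x′ + 𝟙 y′)
  cut-growth f≤t             f≤t             = ≤ᵇ⇒≤ _ _ _
  cut-growth f≤t             (b≤b {false})   = ≤ᵇ⇒≤ _ _ _
  cut-growth f≤t             (b≤b {true})    = ≤ᵇ⇒≤ _ _ _
  cut-growth (b≤b {false})   f≤t             = ≤ᵇ⇒≤ _ _ _
  cut-growth (b≤b {true})    f≤t             = ≤ᵇ⇒≤ _ _ _
  cut-growth (b≤b {false})   (b≤b {false})   = ≤ᵇ⇒≤ _ _ _
  cut-growth (b≤b {false})   (b≤b {true})    = ≤ᵇ⇒≤ _ _ _
  cut-growth (b≤b {true})    (b≤b {false})   = ≤ᵇ⇒≤ _ _ _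
  cut-growth (b≤b {true})    (b≤b {true})    = ≤ᵇ⇒≤ _ _ _

  cut≤endpoints : ∀ x y → 𝟙 (x xor y) ≤ 𝟙 x + 𝟙 y
  cut≤endpoints false y = ≤-refl
  cut≤endpoints true  false = ≤-refl
  cut≤endpoints true  true  = z≤n

  cut-compl : ∀ x y → not x xor not y ≡ x xor y
  cut-compl false y = not-involutive y
  cut-compl true  y = refl

  endpoints-split : ∀ x y → (𝟙 x + 𝟙 y) + (𝟙 (not x) + 𝟙 (not y)) ≡ 2
  endpoints-split false false = refl
  endpoints-split false true  = refl
  endpoints-split true  false = refl
  endpoints-split true  true  = refl

  Vol-mono : ∀ G {S S′ : VSet G} → S ⊆ S′ → Vol G S ≤ Vol G S′
  Vol-mono G {S} {S′} S⊆S′ = begin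
    Vol G S                               ≡⟨ Vol-edges G S ⟩
    sum (map (endpointsIn S) (edges G))  ≤⟨ sum-map-mono (edges G) grow ⟩
    sum (map (endpointsIn S′) (edges G)) ≡⟨ Vol-edges G S′ ⟨
    Vol G S′                              ∎
    where
    open ≤-Reasoning
    grow : ∀ e → endpointsIn S e ≤ endpointsIn S′ e
    grow e = +-mono-≤ (𝟙-mono (S⊆S′ (proj₁ e))) (𝟙-mono (S⊆S′ (proj₂ e)))

  boundary-growth : ∀ G {S S′ : VSet G} → S ⊆ S′ →
    boundary G S′ + Vol G S ≤ boundary G S + Vol G S′
  boundary-growth G {S} {S′} S⊆S′ = begin
    boundary G S′ + Vol G S
      ≡⟨ cong₂ _+_ (boundary-edges G S′) (Vol-edges G S) ⟩
    sum (map (𝟙 ∘ crosses S′) E) + sum (map (endpointsIn S) E)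
      ≡⟨ sum-map-+ (𝟙 ∘ crosses S′) (endpointsIn S) E ⟨
    sum (map (λ e → 𝟙 (crosses S′ e) + endpointsIn S e) E)
      ≤⟨ sum-map-mono E (λ e → cut-growth (S⊆S′ (proj₁ e)) (S⊆S′ (proj₂ e))) ⟩
    sum (map (λ e → 𝟙 (crosses S e) + endpointsIn S′ e) E)
      ≡⟨ sum-map-+ (𝟙 ∘ crosses S) (endpointsIn S′) E ⟩
    sum (map (𝟙 ∘ crosses S) E) + sum (map (endpointsIn S′) E)
      ≡⟨ cong₂ _+_ (boundary-edges G S) (Vol-edges G S′) ⟨
    boundary G S + Vol G S′
      ∎
    where
    open ≤-Reasoning
    E = edges G

  Vol-split : ∀ G (S : VSet G) → Vol G S + Vol G (compl G S) ≡ Vol G (full G)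
  Vol-split G S = begin
    Vol G S + Vol G (compl G S)
      ≡⟨ cong₂ _+_ (Vol-edges G S) (Vol-edges G (compl G S)) ⟩
    sum (map (endpointsIn S) E) + sum (map (endpointsIn (compl G S)) E)
      ≡⟨ sum-map-+ (endpointsIn S) (endpointsIn (compl G S)) E ⟨
    sum (map (λ e → endpointsIn S e + endpointsIn (compl G S) e) E)
      ≡⟨ cong sum (map-cong (λ e → endpoints-split (S (proj₁ e)) (S (proj₂ e))) E) ⟩
    sum (map (endpointsIn (full G)) E)
      ≡⟨ Vol-edges G (full G) ⟨
    Vol G (full G)
      ∎
    where
    open ≡-Reasoning
    E = edges G

  -- |∂S| ≤ min(Vol S, Vol (V∖S)), since ∂S = ∂(V∖S) and every boundary
  -- edge has an endpoint on either side.
  boundary≤minVol : ∀ G (S : VSet G) → boundary G S ≤ minVol G S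
  boundary≤minVol G S =
    ⊓-glb (boundary≤Vol S)
          (subst (_≤ Vol G (compl G S)) boundary-compl (boundary≤Vol (compl G S)))
    where
    boundary≤Vol : ∀ S → boundary G S ≤ Vol G S
    boundary≤Vol S = subst₂ _≤_ (sym (boundary-edges G S)) (sym (Vol-edges G S))
      (sum-map-mono (edges G) (λ e → cut≤endpoints (S (proj₁ e)) (S (proj₂ e))))
    boundary-compl : boundary G (compl G S) ≡ boundary G S
    boundary-compl = trans (boundary-edges G (compl G S))
      (trans (cong sum (map-cong (λ e → cong 𝟙 (cut-compl (S (proj₁ e)) (S (proj₂ e)))) (edges G)))
             (sym (boundary-edges G S)))

-- The arithmetic core, over ℕ. The conductance bound φ = p / D is cleared of
-- denominators; a, c, b are Vol S, Vol (V∖S), |∂S| and a′, c′, b′ the same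
-- quantities for S′.
module Arithmetic where

  open import Data.List using ([]; _∷_)
  open import Data.Nat using (ℕ; _+_; _*_; _≤_; _⊓_; NonZero)
  open import Data.Nat.Properties
  open import Data.Nat.Tactic.RingSolver using (solve)
  open import Data.Sum using ([_,_]′)
  open import Relation.Binary.PropositionalEquality
  open ≤-Reasoning

  five-sixths : ∀ {a c t} → a + c ≡ t → a * 6 ≤ 5 * t → a ≤ 5 * c
  five-sixths {a} {c} {t} split small = +-cancelʳ-≤ (a * 5) a (5 * c) (begin
    a + a * 5       ≡⟨ solve (a ∷ []) ⟩
    a * 6           ≤⟨ small ⟩
    5 * t           ≡⟨ cong (5 *_) split ⟨
    5 * (a + c)     ≡⟨ solve (a ∷ c ∷ []) ⟩
    5 * c + a * 5   ∎)

  new-boundary : ∀ {a a′ b b′ m p} D →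
    b′ + a ≤ b + a′ → b * D ≤ p * m → a′ * D ≤ (D + p) * a →
    b′ * D ≤ p * m + p * a
  new-boundary {a} {a′} {b} {b′} {m} {p} D growth old vol =
    +-cancelʳ-≤ (a * D) (b′ * D) (p * m + p * a) (begin
      b′ * D + a * D        ≡⟨ *-distribʳ-+ D b′ a ⟨
      (b′ + a) * D          ≤⟨ *-monoˡ-≤ D growth ⟩
      (b + a′) * D          ≡⟨ *-distribʳ-+ D b a′ ⟩
      b * D + a′ * D        ≤⟨ +-mono-≤ old vol ⟩
      p * m + (D + p) * a   ≡⟨ solve (a ∷ m ∷ p ∷ D ∷ []) ⟩
      p * m + p * a + a * D ∎)

  complement-shrink : ∀ {a a′ c c′ p} D →
    a′ + c′ ≡ a + c → a′ * D ≤ (D + p) * a → c * D ≤ p * a + c′ * D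
  complement-shrink {a} {a′} {c} {c′} {p} D split vol =
    +-cancelˡ-≤ (a * D) (c * D) (p * a + c′ * D) (begin
      a * D + c * D         ≡⟨ *-distribʳ-+ D a c ⟨
      (a + c) * D           ≡⟨ cong (_* D) split ⟨
      (a′ + c′) * D         ≡⟨ *-distribʳ-+ D a′ c′ ⟩
      a′ * D + c′ * D       ≤⟨ +-monoˡ-≤ (c′ * D) vol ⟩
      (D + p) * a + c′ * D  ≡⟨ solve (a ∷ c′ ∷ p ∷ D ∷ []) ⟩
      a * D + (p * a + c′ * D) ∎)

  large-complement : ∀ {a c c′ p D} .{{_ : NonZero D}} →
    12 * p ≤ D → a ≤ 5 * c → c * D ≤ p * a + c′ * D → c + a ≤ 12 * c′
  large-complement {a} {c} {c′} {p} {D} 12p≤D a≤5c shrink =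
    *-cancelʳ-≤ (c + a) (12 * c′) D (+-cancelʳ-≤ (a * D) _ _ (begin
      (c + a) * D + a * D         ≡⟨ solve (a ∷ c ∷ D ∷ []) ⟩
      c * D + 2 * (a * D)         ≤⟨ +-monoʳ-≤ (c * D) (*-monoʳ-≤ 2 (*-monoˡ-≤ D a≤5c)) ⟩
      c * D + 2 * (5 * c * D)     ≡⟨ solve (c ∷ D ∷ []) ⟩
      11 * (c * D)                ≤⟨ *-monoˡ-≤ (c * D) (n≤1+n 11) ⟩
      12 * (c * D)                ≤⟨ *-monoʳ-≤ 12 shrink ⟩
      12 * (p * a + c′ * D)       ≡⟨ solve (a ∷ c′ ∷ p ∷ D ∷ []) ⟩
      12 * p * a + 12 * c′ * D    ≤⟨ +-monoˡ-≤ (12 * c′ * D) (*-monoˡ-≤ a 12p≤D) ⟩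
      D * a + 12 * c′ * D         ≡⟨ solve (a ∷ c′ ∷ D ∷ []) ⟩
      12 * c′ * D + a * D         ∎))

  conductance-growth : ∀ {a c a′ c′ b b′ t p D} .{{_ : NonZero D}} →
    12 * p ≤ D → b * D ≤ p * (a ⊓ c) → a * 6 ≤ 5 * t → a′ * D ≤ (D + p) * a →
    a + c ≡ t → a′ + c′ ≡ t → a ≤ a′ → b′ + a ≤ b + a′ →
    b′ * D ≤ 12 * p * (a′ ⊓ c′)
  conductance-growth {a} {c} {a′} {c′} {b} {b′} {t} {p} {D}
                     12p≤D old small vol split split′ a≤a′ growth =
    [ S′-smaller , S′-larger ]′ (≤-total a′ c′)
    where
    a≤5c : a ≤ 5 * c
    a≤5c = five-sixths split small

    new : b′ * D ≤ p * (a ⊓ c) + p * a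
    new = new-boundary {a′ = a′} {b = b} D growth old vol

    S′-smaller : a′ ≤ c′ → b′ * D ≤ 12 * p * (a′ ⊓ c′)
    S′-smaller a′≤c′ = begin
      b′ * D               ≤⟨ new ⟩
      p * (a ⊓ c) + p * a  ≤⟨ +-monoˡ-≤ (p * a) (*-monoʳ-≤ p (m⊓n≤m a c)) ⟩
      p * a + p * a        ≡⟨ solve (a ∷ p ∷ []) ⟩
      2 * p * a            ≤⟨ *-mono-≤ (*-monoˡ-≤ p (≤ᵇ⇒≤ 2 12 _)) a≤a′ ⟩
      12 * p * a′          ≡⟨ cong (12 * p *_) (m≤n⇒m⊓n≡m a′≤c′) ⟨
      12 * p * (a′ ⊓ c′)   ∎

    S′-larger : c′ ≤ a′ → b′ * D ≤ 12 * p * (a′ ⊓ c′)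
    S′-larger c′≤a′ = begin
      b′ * D               ≤⟨ new ⟩
      p * (a ⊓ c) + p * a  ≤⟨ +-monoˡ-≤ (p * a) (*-monoʳ-≤ p (m⊓n≤n a c)) ⟩
      p * c + p * a        ≡⟨ *-distribˡ-+ p c a ⟨
      p * (c + a)          ≤⟨ *-monoʳ-≤ p (large-complement {c′ = c′} {p} 12p≤D a≤5c
                                 (complement-shrink {a′ = a′} D (trans split′ (sym split)) vol)) ⟩
      p * (12 * c′)        ≡⟨ solve (c′ ∷ p ∷ []) ⟩
      12 * p * c′          ≡⟨ cong (12 * p *_) (m≥n⇒m⊓n≡n c′≤a′) ⟨
      12 * p * (a′ ⊓ c′)   ∎

module Fractions where

  open EdgeCounting using (boundary≤minVol)
  open import Data.List using ([]; _∷_)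
  open import Data.Nat using (ℕ; zero; suc; _+_; _*_; _≤_; z≤n)
  open import Data.Nat.Properties
  open import Data.Nat.Tactic.RingSolver using (solve)
  import Data.Integer as ℤ
  open import Data.Integer.Properties using (pos-*; pos-+; drop‿+≤+)
  open import Data.Rational as ℚ using (ℚ; _/_; 0ℚ; 1ℚ; toℚᵘ)
  open import Data.Rational.Properties
    using (toℚᵘ-mono-≤; toℚᵘ-cancel-≤; toℚᵘ-fromℚᵘ; toℚᵘ-homo-*; toℚᵘ-homo-+)
  open import Data.Rational.Unnormalised as ℚᵘ using (mkℚᵘ; *≤*)
  open import Data.Rational.Unnormalised.Properties as ℚᵘP
    using (≤-respˡ-≃; ≤-respʳ-≃; ≃-refl; ≃-sym; ≃-trans; ≃-reflexive)
  open import Relation.Binary.PropositionalEquality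

  -- r ≐ x /suc k : the rational r equals the fraction x / (k + 1).
  infix 4 _≐_/suc_
  _≐_/suc_ : ℚ → ℕ → ℕ → Set
  r ≐ x /suc k = toℚᵘ r ℚᵘ.≃ mkℚᵘ (ℤ.+ x) k

  /-≐ : ∀ x k → (ℤ.+ x / suc k) ≐ x /suc k
  /-≐ x k = toℚᵘ-fromℚᵘ (mkℚᵘ (ℤ.+ x) k)

  *-≐ : ∀ {r s x y k l} → r ≐ x /suc k → s ≐ y /suc l →
    (r ℚ.* s) ≐ x * y /suc (l + k * suc l)
  *-≐ {r} {s} {x} {y} r≐ s≐ =
    ≃-trans (toℚᵘ-homo-* r s)
      (≃-trans (ℚᵘP.*-cong r≐ s≐) (≃-reflexive (cong (λ z → mkℚᵘ z _) (sym (pos-* x y)))))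

  +-≐ : ∀ {r s x y k l} → r ≐ x /suc k → s ≐ y /suc l →
    (r ℚ.+ s) ≐ x * suc l + y * suc k /suc (l + k * suc l)
  +-≐ {r} {s} {x} {y} {k} {l} r≐ s≐ =
    ≃-trans (toℚᵘ-homo-+ r s)
      (≃-trans (ℚᵘP.+-cong r≐ s≐) (≃-reflexive (cong (λ z → mkℚᵘ z _) (sym numerator))))
    where
    numerator : ℤ.+ (x * suc l + y * suc k) ≡ ℤ.+ x ℤ.* ℤ.+ suc l ℤ.+ ℤ.+ y ℤ.* ℤ.+ suc k
    numerator = trans (pos-+ (x * suc l) (y * suc k))
                      (cong₂ ℤ._+_ (pos-* x (suc l)) (pos-* y (suc k)))

  ≤-cross : ∀ {r s x y k l} → r ≐ x /suc k → s ≐ y /suc l →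
    r ℚ.≤ s → x * suc l ≤ y * suc k
  ≤-cross {x = x} {y} {k} {l} r≐ s≐ r≤s
    with ≤-respˡ-≃ r≐ (≤-respʳ-≃ s≐ (toℚᵘ-mono-≤ r≤s))
  ... | *≤* cross rewrite sym (pos-* x (suc l)) | sym (pos-* y (suc k)) = drop‿+≤+ cross

  ≤-cross⁻ : ∀ {r s x y k l} → r ≐ x /suc k → s ≐ y /suc l →
    x * suc l ≤ y * suc k → r ℚ.≤ s
  ≤-cross⁻ {x = x} {y} {k} {l} r≐ s≐ cross =
    toℚᵘ-cancel-≤ (≤-respˡ-≃ (≃-sym r≐) (≤-respʳ-≃ (≃-sym s≐)
      (*≤* (subst₂ ℤ._≤_ (pos-* x (suc l)) (pos-* y (suc k)) (ℤ.+≤+ cross)))))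

  Φ-nonNeg : ∀ G S → 0ℚ ℚ.≤ Φ G S
  Φ-nonNeg G S with minVol G S
  ... | zero  = ≤-cross⁻ ≃-refl ≃-refl z≤n
  ... | suc m = ≤-cross⁻ ≃-refl (/-≐ (boundary G S) m) z≤n

  -- Φ(S) ≤ x / (k + 1) iff |∂S|·(k + 1) ≤ x·min(Vol S, Vol (V∖S)); when the
  -- minimum vanishes so does the boundary.
  Φ≤⇒ : ∀ G S {r x k} → r ≐ x /suc k →
    Φ G S ℚ.≤ r → boundary G S * suc k ≤ x * minVol G S
  Φ≤⇒ G S {x = x} {k} r≐ Φ≤r with minVol G S | boundary≤minVol G S
  ... | zero  | ∂≤0 = subst (λ b → b * suc k ≤ x * 0) (sym (n≤0⇒n≡0 ∂≤0)) z≤n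
  ... | suc m | _   = ≤-cross (/-≐ (boundary G S) m) r≐ Φ≤r

  ⇒Φ≤ : ∀ G S {r x k} → r ≐ x /suc k →
    boundary G S * suc k ≤ x * minVol G S → Φ G S ℚ.≤ r
  ⇒Φ≤ G S r≐ cross with minVol G S
  ... | zero  = ≤-cross⁻ ≃-refl r≐ z≤n
  ... | suc m = ≤-cross⁻ (/-≐ (boundary G S) m) r≐ cross

  ≤1/12⇒ : ∀ {φ p d} → φ ≐ p /suc d → φ ℚ.≤ ℤ.+ 1 / 12 → 12 * p ≤ suc d
  ≤1/12⇒ {p = p} {d} φ≐ φ≤ =
    subst₂ _≤_ (*-comm p 12) (*-identityˡ (suc d)) (≤-cross φ≐ (/-≐ 1 11) φ≤)

  ≤5/6⇒ : ∀ a t → (ℤ.+ a / 1) ℚ.≤ (ℤ.+ 5 / 6) ℚ.* (ℤ.+ t / 1) → a * 6 ≤ 5 * t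
  ≤5/6⇒ a t a≤ =
    subst (a * 6 ≤_) (*-identityʳ (5 * t)) (≤-cross (/-≐ a 0) (*-≐ (/-≐ 5 5) (/-≐ t 0)) a≤)

  ≤1+φ⇒ : ∀ {φ p d} a′ a → φ ≐ p /suc d →
    (ℤ.+ a′ / 1) ℚ.≤ (1ℚ ℚ.+ φ) ℚ.* (ℤ.+ a / 1) → a′ * suc d ≤ (suc d + p) * a
  ≤1+φ⇒ {φ} {p} {d} a′ a φ≐ a′≤ = begin
    a′ * suc d                          ≡⟨ solve (a′ ∷ d ∷ []) ⟩
    a′ * suc ((d + 0) * 1)              ≤⟨ ≤-cross (/-≐ a′ 0) (*-≐ (+-≐ ≃-refl φ≐) (/-≐ a 0)) a′≤ ⟩
    (1 * suc d + p * 1) * a * 1         ≡⟨ solve (a ∷ p ∷ d ∷ []) ⟩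
    (suc d + p) * a                     ∎
    where open ≤-Reasoning

  12φ≐ : ∀ {φ p d} → φ ≐ p /suc d → (ℤ.+ 12 / 1) ℚ.* φ ≐ 12 * p /suc d
  12φ≐ {φ} {p} {d} φ≐ =
    subst (λ k → (ℤ.+ 12 / 1) ℚ.* φ ≐ 12 * p /suc k) (+-identityʳ d) (*-≐ (/-≐ 12 0) φ≐)

open EdgeCounting using (_⊆_; prefix-mono; Vol-mono; boundary-growth; Vol-split)
open Arithmetic using (conductance-growth)
open Fractions using (_≐_/suc_; Φ-nonNeg; Φ≤⇒; ⇒Φ≤; ≤1/12⇒; ≤5/6⇒; ≤1+φ⇒; 12φ≐)

open import Data.Nat using (ℕ; _≤_; _<_)
open import Data.Nat.Properties using (<⇒≤)
open import Data.Integer using (+_; -[1+_])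
open import Data.Rational using (ℚ; mkℚ; _/_; _*_; _+_; 1ℚ; *≤*) renaming (_≤_ to _≤ℚ_)
import Data.Rational.Properties as ℚP
open import Data.Rational.Unnormalised.Properties using (≃-refl)
open import Data.Fin.Permutation using (Permutation′)

-- A negative φ is impossible since Φ ≥ 0; for φ = p/(d+1) the hypotheses are
-- translated to ℕ, combined with the edge-counting facts for the nested
-- prefixes S ⊆ S′, and the arithmetic core gives |∂S′|·(d+1) ≤ 12p·minVol S′.
lemma8 : (G : Graph) (π : Permutation′ (n G)) (φ : ℚ) → φ ≤ℚ (+ 1 / 12) →
    (j : ℕ) → 1 ≤ j → j ≤ n G →
    Φ G (prefix G π j) ≤ℚ φ →
    (+ Vol G (prefix G π j) / 1) ≤ℚ (+ 5 / 6) * (+ Vol G (full G) / 1) →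
    (j′ : ℕ) → j < j′ → j′ ≤ n G →
    (+ Vol G (prefix G π j′) / 1) ≤ℚ (1ℚ + φ) * (+ Vol G (prefix G π j) / 1) →
    Φ G (prefix G π j′) ≤ℚ (+ 12 / 1) * φ
lemma8 G π (mkℚ -[1+ p ] d _) _ j _ _ Φ≤φ _ _ _ _ _
  with ℚP.≤-trans (Φ-nonNeg G (prefix G π j)) Φ≤φ
... | *≤* ()
lemma8 G π φ@(mkℚ (+ p) d _) φ≤1/12 j _ _ Φ≤φ small j′ j<j′ _ grows =
  ⇒Φ≤ G S′ (12φ≐ {φ} φ≐)
    (conductance-growth (≤1/12⇒ φ≐ φ≤1/12) (Φ≤⇒ G S φ≐ Φ≤φ)
                        (≤5/6⇒ (Vol G S) (Vol G (full G)) small)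
                        (≤1+φ⇒ {φ} (Vol G S′) (Vol G S) φ≐ grows)
                        (Vol-split G S) (Vol-split G S′)
                        (Vol-mono G S⊆S′) (boundary-growth G S⊆S′))
  where
  S S′ : VSet G
  S  = prefix G π j
  S′ = prefix G π j′
  S⊆S′ : S ⊆ S′
  S⊆S′ = prefix-mono G π (<⇒≤ j<j′)
  φ≐ : φ ≐ p /suc d
  φ≐ = ≃-refl
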